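{- Let $G$ be a connected claw-free cubic graph which has a good decomposition $\{T, M, O\}$, and let $C$ be a cycle in $G\setminus E(T)$ (the graph obtained from $G$ by deleting the edges of the spanning tree $T$). Then either $C$ is a triangle, or all of the following hold: (i) $C$ is a chordless cycle; (ii) no vertex of $C$ lies in a diamond of $G$; (iii) $C$ has even length.
   Context: All graphs are finite, undirected, without loops or multiple edges. A graph is cubic if every vertex has degree $3$; claw-free if it has no induced subgraph isomorphic to $K_{1,3}$. A good decomposition $\{T,M,O\}$ of $G$ is a partition of $E(G)$ into the edge set of a spanning tree $T$, a matching $M$ (possibly empty) and the edge set of a $2$-regular subgraph $O$. A diamond is the complete graph $K_4$ minus one edge; a vertex lies in a diamond of $G$ if it belongs to a subgraph of $G$ isomorphic to a diamond. A cycle is chordless if no edge of $G$ joins two non-consecutive vertices of the cycle. -}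

module Defs where

open import Data.Nat using (ℕ; zero; suc; _+_; _≤_)
open import Data.Nat.DivMod using (_mod_)
open import Data.Nat.Divisibility using (_∣_)
open import Data.Fin using (Fin; toℕ)
open import Data.Bool using (Bool; true; false)
open import Data.Product using (Σ; ∃; ∃-syntax; _×_; _,_)
open import Data.Sum using (_⊎_)
open import Relation.Binary.PropositionalEquality using (_≡_; _≢_)
open import Relation.Nullary using (¬_)
open import Function.Definitions using (Injective)

EdgeRel : ℕ → Set
EdgeRel n = Fin n → Fin n → Bool

_∋_─_ : ∀ {n} → EdgeRel n → Fin n → Fin n → Set
E ∋ u ─ v = E u v ≡ true

record Graph (n : ℕ) : Set where
  field
    adj    : EdgeRel n
    sym    : ∀ u v → adj ∋ u ─ v → adj ∋ v ─ u
    irrefl : ∀ v → ¬ (adj ∋ v ─ v)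
open Graph public

record EdgeSubset {n} (G : Graph n) (F : EdgeRel n) : Set where
  field
    sub : ∀ u v → F ∋ u ─ v → adj G ∋ u ─ v
    sym : ∀ u v → F ∋ u ─ v → F ∋ v ─ u

_∖_ : ∀ {n} → EdgeRel n → EdgeRel n → EdgeRel n
(F ∖ H) u v with H u v
... | true  = false
... | false = F u v

HasExactly3Nbrs : ∀ {n} → EdgeRel n → Fin n → Set
HasExactly3Nbrs E v =
  Σ (Fin _) λ a → Σ (Fin _) λ b → Σ (Fin _) λ c →
    a ≢ b × a ≢ c × b ≢ c ×
    E ∋ v ─ a × E ∋ v ─ b × E ∋ v ─ c ×
    (∀ w → E ∋ v ─ w → w ≡ a ⊎ w ≡ b ⊎ w ≡ c)

HasExactly2Nbrs : ∀ {n} → EdgeRel n → Fin n → Set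
HasExactly2Nbrs E v =
  Σ (Fin _) λ a → Σ (Fin _) λ b →
    a ≢ b × E ∋ v ─ a × E ∋ v ─ b ×
    (∀ w → E ∋ v ─ w → w ≡ a ⊎ w ≡ b)

HasNoNbr : ∀ {n} → EdgeRel n → Fin n → Set
HasNoNbr E v = ∀ w → ¬ (E ∋ v ─ w)

Cubic : ∀ {n} → Graph n → Set
Cubic G = ∀ v → HasExactly3Nbrs (adj G) v

ClawFree : ∀ {n} → Graph n → Set
ClawFree {n} G = ¬ (Σ (Fin n) λ v → Σ (Fin n) λ a → Σ (Fin n) λ b → Σ (Fin n) λ c →
    a ≢ b × a ≢ c × b ≢ c ×
    adj G ∋ v ─ a × adj G ∋ v ─ b × adj G ∋ v ─ c ×
    ¬ (adj G ∋ a ─ b) × ¬ (adj G ∋ a ─ c) × ¬ (adj G ∋ b ─ c))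

data Reach {n} (E : EdgeRel n) : Fin n → Fin n → Set where
  here : ∀ {u} → Reach E u u
  step : ∀ {u v w} → E ∋ u ─ v → Reach E v w → Reach E u w

ConnectedVia : ∀ {n} → EdgeRel n → Set
ConnectedVia {n} E = ∀ (u v : Fin n) → Reach E u v

Connected : ∀ {n} → Graph n → Set
Connected G = ConnectedVia (adj G)

next : ∀ {m} → Fin (3 + m) → Fin (3 + m)
next {m} i = suc (toℕ i) mod (3 + m)

record Cycle {n} (E : EdgeRel n) : Set where
  field
    m      : ℕ
    vert   : Fin (3 + m) → Fin n
    inj    : Injective _≡_ _≡_ vert
    edges  : ∀ i → E ∋ vert i ─ vert (next i)

  len : ℕ
  len = 3 + m
open Cycle public

Acyclic : ∀ {n} → EdgeRel n → Set
Acyclic E = ¬ Cycle E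

SpanningTree : ∀ {n} → Graph n → EdgeRel n → Set
SpanningTree G T = EdgeSubset G T × ConnectedVia T × Acyclic T

Matching : ∀ {n} → Graph n → EdgeRel n → Set
Matching G M = EdgeSubset G M × (∀ u v w → M ∋ u ─ v → M ∋ u ─ w → v ≡ w)

TwoRegularEdges : ∀ {n} → Graph n → EdgeRel n → Set
TwoRegularEdges G O = EdgeSubset G O × (∀ v → HasNoNbr O v ⊎ HasExactly2Nbrs O v)

Partition3 : ∀ {n} → Graph n → EdgeRel n → EdgeRel n → EdgeRel n → Set
Partition3 {n} G T M O = ∀ (u v : Fin n) → adj G ∋ u ─ v →
    (T ∋ u ─ v ⊎ M ∋ u ─ v ⊎ O ∋ u ─ v) ×
    ¬ (T ∋ u ─ v × M ∋ u ─ v) × ¬ (T ∋ u ─ v × O ∋ u ─ v) × ¬ (M ∋ u ─ v × O ∋ u ─ v)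

record GoodDecomposition {n} (G : Graph n) (T M O : EdgeRel n) : Set where
  field
    tree      : SpanningTree G T
    matching  : Matching G M
    twoReg    : TwoRegularEdges G O
    partition : Partition3 G T M O

IsTriangle : ∀ {n} {E : EdgeRel n} → Cycle E → Set
IsTriangle C = m C ≡ 0

Chordless : ∀ {n} {E : EdgeRel n} → Graph n → Cycle E → Set
Chordless G C = ∀ i j → adj G ∋ vert C i ─ vert C j → j ≡ next i ⊎ i ≡ next j

-- v lies in a (not necessarily induced) subgraph isomorphic to K₄ minus an edge:
-- distinct a b c d with edges ab ac ad bc bd (cd need not be absent).
InDiamond : ∀ {n} → Graph n → Fin n → Set
InDiamond {n} G v = Σ (Fin n) λ a → Σ (Fin n) λ b → Σ (Fin n) λ c → Σ (Fin n) λ d →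
    a ≢ b × a ≢ c × a ≢ d × b ≢ c × b ≢ d × c ≢ d ×
    adj G ∋ a ─ b × adj G ∋ a ─ c × adj G ∋ a ─ d × adj G ∋ b ─ c × adj G ∋ b ─ d ×
    (v ≡ a ⊎ v ≡ b ⊎ v ≡ c ⊎ v ≡ d)

EvenLength : ∀ {n} {E : EdgeRel n} → Cycle E → Set
EvenLength C = 2 ∣ len C

module Submission where

-- Let C be a cycle of length L ≥ 4 in G ∖ E(T), write v₀, v₁, … for its
-- vertices (indices taken mod L) and t(x) for a T-neighbour of x.
-- Each vᵢ already has two non-tree edges on C, so by cubicity its third
-- neighbour is t(vᵢ) and vᵢ is a leaf of T.  Connectivity of T then forbids
-- small T-closed vertex sets: t(vᵢ) never lies on C (else {vᵢ, t(vᵢ)} would be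
-- closed), which makes C chordless, and no three consecutive vertices share
-- their tree neighbour (else that vertex with its three leaves would be closed).
-- Claw-freeness at vᵢ₊₁ forces t(vᵢ₊₁) to equal t(vᵢ) or t(vᵢ₊₂), so the
-- property "t(vᵢ) = t(vᵢ₊₁)" alternates along C; being L-periodic, L is even.
-- Finally a diamond through C would give an edge at a cycle vertex lying in
-- two triangles, which the neighbourhood {vᵢ₋₁, vᵢ₊₁, t(vᵢ)} does not allow.

open import Defs
open import Data.Nat using (ℕ; zero; suc; _+_; _*_; _∸_; _<_; _%_; NonZero; s≤s; z≤n; _<?_)
  renaming (_≟_ to _≟ℕ_)
open import Data.Nat.Properties
  using (<⇒≢; >⇒≢; m<n+m; ≮⇒≥; <-trans; ∸-monoˡ-<; +-monoˡ-<; +-monoʳ-<; m+n∸m≡n; +-suc; n≢0⇒n>0)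
open import Data.Nat.DivMod
  using (_mod_; m%n<n; m<n⇒m%n≡m; m≤n⇒[n∸m]%m≡n%m; %-distribˡ-+; m%n%n≡m%n; %-remove-+ˡ)
open import Data.Nat.Divisibility using (_∣_; divides; ∣-refl)
open import Data.Fin using (Fin; toℕ) renaming (_≟_ to _≟F_)
open import Data.Fin.Properties using (toℕ-injective; toℕ-fromℕ<; toℕ<n)
open import Data.Bool using (true; false)
open import Data.Bool.Properties using () renaming (_≟_ to _≟B_)
open import Data.Product using (Σ; _×_; _,_; proj₁; proj₂)
open import Data.Sum using (_⊎_; inj₁; inj₂)
open import Data.Empty using (⊥; ⊥-elim)
open import Function using (_∘_)
open import Relation.Nullary using (¬_; Dec; yes; no)
open import Relation.Binary.PropositionalEquality
  using (_≡_; _≢_; refl; cong; subst; trans; module ≡-Reasoning)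
  renaming (sym to ≡-sym)

∖-sub : ∀ {n} (F H : EdgeRel n) {u w} → (F ∖ H) ∋ u ─ w → F ∋ u ─ w
∖-sub F H {u} {w} e with H u w
∖-sub F H () | true
∖-sub F H e  | false = e

∖-avoids : ∀ {n} (F H : EdgeRel n) {u w} → (F ∖ H) ∋ u ─ w → ¬ (H ∋ u ─ w)
∖-avoids F H {u} {w} e h with H u w
∖-avoids F H () h | true
∖-avoids F H e () | false

module _ {A : Set} where

  OneOf : A → A → A → A → Set
  OneOf a b c x = x ≡ a ⊎ x ≡ b ⊎ x ≡ c

  three-in-two : ∀ {a b x y z : A} → (x ≡ a ⊎ x ≡ b) → (y ≡ a ⊎ y ≡ b) → (z ≡ a ⊎ z ≡ b) →
                 x ≢ y → x ≢ z → y ≢ z → ⊥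
  three-in-two (inj₁ refl) (inj₁ refl) _           x≢y _   _   = x≢y refl
  three-in-two (inj₂ refl) (inj₂ refl) _           x≢y _   _   = x≢y refl
  three-in-two (inj₁ refl) (inj₂ refl) (inj₁ refl) _   x≢z _   = x≢z refl
  three-in-two (inj₁ refl) (inj₂ refl) (inj₂ refl) _   _   y≢z = y≢z refl
  three-in-two (inj₂ refl) (inj₁ refl) (inj₁ refl) _   _   y≢z = y≢z refl
  three-in-two (inj₂ refl) (inj₁ refl) (inj₂ refl) _   x≢z _   = x≢z refl

  drop₁ : ∀ {a b c x : A} → OneOf a b c x → x ≢ a → x ≡ b ⊎ x ≡ c
  drop₁ (inj₁ x≡a) x≢a = ⊥-elim (x≢a x≡a)
  drop₁ (inj₂ x∈bc) _  = x∈bc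

  drop₂ : ∀ {a b c x : A} → OneOf a b c x → x ≢ b → x ≡ a ⊎ x ≡ c
  drop₂ (inj₁ x≡a)        _   = inj₁ x≡a
  drop₂ (inj₂ (inj₁ x≡b)) x≢b = ⊥-elim (x≢b x≡b)
  drop₂ (inj₂ (inj₂ x≡c)) _   = inj₂ x≡c

  drop₃ : ∀ {a b c x : A} → OneOf a b c x → x ≢ c → x ≡ a ⊎ x ≡ b
  drop₃ (inj₁ x≡a)        _   = inj₁ x≡a
  drop₃ (inj₂ (inj₁ x≡b)) _   = inj₂ x≡b
  drop₃ (inj₂ (inj₂ x≡c)) x≢c = ⊥-elim (x≢c x≡c)

  four-in-three : ∀ {a b c w x y z : A} →
    OneOf a b c w → OneOf a b c x → OneOf a b c y → OneOf a b c z →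
    w ≢ x → w ≢ y → w ≢ z → x ≢ y → x ≢ z → y ≢ z → ⊥
  four-in-three (inj₁ refl) x∈ y∈ z∈ w≢x w≢y w≢z =
    three-in-two (drop₁ x∈ (w≢x ∘ ≡-sym)) (drop₁ y∈ (w≢y ∘ ≡-sym)) (drop₁ z∈ (w≢z ∘ ≡-sym))
  four-in-three (inj₂ (inj₁ refl)) x∈ y∈ z∈ w≢x w≢y w≢z =
    three-in-two (drop₂ x∈ (w≢x ∘ ≡-sym)) (drop₂ y∈ (w≢y ∘ ≡-sym)) (drop₂ z∈ (w≢z ∘ ≡-sym))
  four-in-three (inj₂ (inj₂ refl)) x∈ y∈ z∈ w≢x w≢y w≢z =
    three-in-two (drop₃ x∈ (w≢x ∘ ≡-sym)) (drop₃ y∈ (w≢y ∘ ≡-sym)) (drop₃ z∈ (w≢z ∘ ≡-sym))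

  distinct-in-pair : ∀ {a b x y : A} → (x ≡ a ⊎ x ≡ b) → (y ≡ a ⊎ y ≡ b) → x ≢ y →
                     (x ≡ a × y ≡ b) ⊎ (x ≡ b × y ≡ a)
  distinct-in-pair (inj₁ x≡a)  (inj₂ y≡b)  _   = inj₁ (x≡a , y≡b)
  distinct-in-pair (inj₂ x≡b)  (inj₁ y≡a)  _   = inj₂ (x≡b , y≡a)
  distinct-in-pair (inj₁ refl) (inj₁ refl) x≢y = ⊥-elim (x≢y refl)
  distinct-in-pair (inj₂ refl) (inj₂ refl) x≢y = ⊥-elim (x≢y refl)

  one-in-first-two : ∀ {a b c x y : A} → OneOf a b c x → OneOf a b c y → x ≢ y →
                     (x ≡ a ⊎ x ≡ b) ⊎ (y ≡ a ⊎ y ≡ b)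
  one-in-first-two (inj₁ x≡a)        _                 _   = inj₁ (inj₁ x≡a)
  one-in-first-two (inj₂ (inj₁ x≡b)) _                 _   = inj₁ (inj₂ x≡b)
  one-in-first-two (inj₂ (inj₂ _))   (inj₁ y≡a)        _   = inj₂ (inj₁ y≡a)
  one-in-first-two (inj₂ (inj₂ _))   (inj₂ (inj₁ y≡b)) _   = inj₂ (inj₂ y≡b)
  one-in-first-two (inj₂ (inj₂ refl)) (inj₂ (inj₂ refl)) x≢y = ⊥-elim (x≢y refl)

three-neighbours : ∀ {n} (E : EdgeRel n) {x p q r w : Fin n} → HasExactly3Nbrs E x →
  p ≢ q → p ≢ r → q ≢ r → E ∋ x ─ p → E ∋ x ─ q → E ∋ x ─ r → E ∋ x ─ w → OneOf p q r w
three-neighbours E {p = p} {q} {r} {w} (_ , _ , _ , _ , _ , _ , _ , _ , _ , only) p≢q p≢r q≢r xp xq xr xw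
  with w ≟F p | w ≟F q | w ≟F r
... | yes w≡p | _       | _       = inj₁ w≡p
... | no _    | yes w≡q | _       = inj₂ (inj₁ w≡q)
... | no _    | no _    | yes w≡r = inj₂ (inj₂ w≡r)
... | no w≢p  | no w≢q  | no w≢r  =
  ⊥-elim (four-in-three (only w xw) (only p xp) (only q xq) (only r xr) w≢p w≢q w≢r p≢q p≢r q≢r)

-- A vertex set closed under E-edges; in a connected E, any nonempty such set
-- contains every vertex.  This is how connectivity of the tree is used.
Closed : ∀ {n} → EdgeRel n → (Fin n → Set) → Set
Closed {n} E S = ∀ (x y : Fin n) → S x → E ∋ x ─ y → S y

closed-reach : ∀ {n} {E : EdgeRel n} {S : Fin n → Set} → Closed E S → ∀ {x y} → Reach E x y → S x → S y
closed-reach closed here        Sx = Sx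
closed-reach closed (step e xy) Sx = closed-reach closed xy (closed _ _ Sx e)

closed-total : ∀ {n} {E : EdgeRel n} {S : Fin n → Set} → ConnectedVia E → Closed E S →
               ∀ {x} → S x → ∀ y → S y
closed-total connected closed {x} Sx y = closed-reach closed (connected x y) Sx

first-edge : ∀ {n} {E : EdgeRel n} {u w : Fin n} → Reach E u w → u ≢ w → Σ (Fin n) λ y → E ∋ u ─ y
first-edge here         u≢u = ⊥-elim (u≢u refl)
first-edge (step e _)   _   = _ , e

shift-mod-≢ : ∀ {L r j} .{{_ : NonZero L}} → r < L → 0 < j → j < L → (j + r) % L ≢ r
shift-mod-≢ {L} {r} {j} r<L 0<j j<L with j + r <? L
... | yes j+r<L = λ e → >⇒≢ (m<n+m r 0<j) (trans (≡-sym (m<n⇒m%n≡m j+r<L)) e)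
... | no  j+r≮L = λ e → <⇒≢ wrapped<r (begin
      j + r ∸ L        ≡⟨ ≡-sym (m<n⇒m%n≡m (<-trans wrapped<r r<L)) ⟩
      (j + r ∸ L) % L  ≡⟨ m≤n⇒[n∸m]%m≡n%m (≮⇒≥ j+r≮L) ⟩
      (j + r) % L      ≡⟨ e ⟩
      r                ∎)
  where
    open ≡-Reasoning
    wrapped<r : j + r ∸ L < r
    wrapped<r = subst (j + r ∸ L <_) (m+n∸m≡n L r) (∸-monoˡ-< (+-monoˡ-< r j<L) (≮⇒≥ j+r≮L))

module CyclicIndexing {n} {E : EdgeRel n} (C : Cycle E) where

  L : ℕ
  L = len C

  pos : ℕ → Fin L
  pos k = k mod L

  v : ℕ → Fin n
  v k = vert C (pos k)

  toℕ-pos : ∀ k → toℕ (pos k) ≡ k % L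
  toℕ-pos k = toℕ-fromℕ< (m%n<n k L)

  pos-toℕ : ∀ i → pos (toℕ i) ≡ i
  pos-toℕ i = toℕ-injective (trans (toℕ-pos (toℕ i)) (m<n⇒m%n≡m (toℕ<n i)))

  pos-suc : ∀ k → pos (suc k) ≡ next (pos k)
  pos-suc k = toℕ-injective (begin
    toℕ (pos (suc k))           ≡⟨ toℕ-pos (suc k) ⟩
    suc k % L                   ≡⟨ %-distribˡ-+ 1 k L ⟩
    (1 % L + k % L) % L         ≡⟨ cong (λ r → (1 % L + r) % L) (≡-sym (m%n%n≡m%n k L)) ⟩
    (1 % L + k % L % L) % L     ≡⟨ ≡-sym (%-distribˡ-+ 1 (k % L) L) ⟩
    suc (k % L) % L             ≡⟨ cong (λ r → suc r % L) (≡-sym (toℕ-pos k)) ⟩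
    suc (toℕ (pos k)) % L       ≡⟨ ≡-sym (toℕ-pos (suc (toℕ (pos k)))) ⟩
    toℕ (next (pos k))          ∎)
    where open ≡-Reasoning

  pos-periodic : ∀ k → pos (L + k) ≡ pos k
  pos-periodic k = toℕ-injective (begin
    toℕ (pos (L + k))  ≡⟨ toℕ-pos (L + k) ⟩
    (L + k) % L        ≡⟨ %-remove-+ˡ k ∣-refl ⟩
    k % L              ≡⟨ ≡-sym (toℕ-pos k) ⟩
    toℕ (pos k)        ∎)
    where open ≡-Reasoning

  pos-distinct : ∀ k j → 0 < j → j < L → pos k ≢ pos (j + k)
  pos-distinct k j 0<j j<L same = shift-mod-≢ (m%n<n k L) 0<j j<L (begin
    (j + k % L) % L      ≡⟨ cong (λ r → (r + k % L) % L) (≡-sym (m<n⇒m%n≡m j<L)) ⟩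
    (j % L + k % L) % L  ≡⟨ ≡-sym (%-distribˡ-+ j k L) ⟩
    (j + k) % L          ≡⟨ ≡-sym (toℕ-pos (j + k)) ⟩
    toℕ (pos (j + k))    ≡⟨ cong toℕ (≡-sym same) ⟩
    toℕ (pos k)          ≡⟨ toℕ-pos k ⟩
    k % L                ∎)
    where open ≡-Reasoning

  v-edge : ∀ k → E ∋ v k ─ v (suc k)
  v-edge k = subst (λ i → E ∋ v k ─ vert C i) (≡-sym (pos-suc k)) (edges C (pos k))

  v-toℕ : ∀ i → v (toℕ i) ≡ vert C i
  v-toℕ i = cong (vert C) (pos-toℕ i)

  v-periodic : ∀ k → v (L + k) ≡ v k
  v-periodic k = cong (vert C) (pos-periodic k)

  v-distinct : ∀ k j → 0 < j → j < L → v k ≢ v (j + k)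
  v-distinct k j 0<j j<L = pos-distinct k j 0<j j<L ∘ inj C

  -- Every index is a successor index up to the period; lemmas stated at
  -- v (suc k), whose two cycle neighbours are v k and v (2 + k), transfer
  -- to arbitrary indices through this.
  v-as-successor : ∀ j → v j ≡ v (suc (2 + m C + j))
  v-as-successor j = ≡-sym (v-periodic j)

  pos-as-successor : ∀ i → pos (suc (2 + m C + toℕ i)) ≡ i
  pos-as-successor i = trans (pos-periodic (toℕ i)) (pos-toℕ i)

  vert-as-successor : ∀ i → vert C i ≡ v (suc (2 + m C + toℕ i))
  vert-as-successor i = cong (vert C) (≡-sym (pos-as-successor i))

even-or-odd : ∀ k → 2 ∣ k ⊎ Σ ℕ λ j → k ≡ suc (j * 2)
even-or-odd zero = inj₁ (divides 0 refl)
even-or-odd (suc k) with even-or-odd k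
... | inj₁ (divides j k≡2j) = inj₂ (j , cong suc k≡2j)
... | inj₂ (j , k≡2j+1)     = inj₁ (divides (suc j) (cong suc k≡2j+1))

alternating-two-steps : (s : ℕ → Set) → (∀ k → s k ⊎ s (suc k)) → (∀ k → ¬ (s k × s (suc k))) →
                        ∀ i {k} → s k → s (i * 2 + k)
alternating-two-steps s one-of not-both zero    sk = sk
alternating-two-steps s one-of not-both (suc i) {k} sk with one-of (suc (i * 2 + k))
... | inj₁ s-odd  = ⊥-elim (not-both (i * 2 + k) (alternating-two-steps s one-of not-both i sk , s-odd))
... | inj₂ s-even = s-even

alternating-period-even : (s : ℕ → Set) → (∀ k → s k ⊎ s (suc k)) → (∀ k → ¬ (s k × s (suc k))) →
                          ∀ L → (∀ k → s k → s (L + k)) → 2 ∣ L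
alternating-period-even s one-of not-both L periodic with even-or-odd L
... | inj₁ even       = even
... | inj₂ (j , refl) = ⊥-elim (odd-period (one-of 0))
  where
    -- with L = 2j + 1, s k forces s (2j + k) and, by periodicity, s (2j + k + 1)
    odd-period : s 0 ⊎ s 1 → ⊥
    odd-period (inj₁ s₀) = not-both (j * 2 + 0) (alternating-two-steps s one-of not-both j s₀ , periodic 0 s₀)
    odd-period (inj₂ s₁) = not-both (j * 2 + 1) (alternating-two-steps s one-of not-both j s₁ , periodic 1 s₁)

module CycleOffTree {n : ℕ} (G : Graph n) (claw-free : ClawFree G) (cubic : Cubic G)
                    (T : EdgeRel n) (T⊆G : EdgeSubset G T) (T-connected : ConnectedVia T)
                    (C : Cycle (adj G ∖ T)) (long : 0 < m C) where

  open CyclicIndexing C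

  _~_ : Fin n → Fin n → Set
  x ~ y = adj G ∋ x ─ y

  adjacent? : ∀ x y → Dec (x ~ y)
  adjacent? x y = adj G x y ≟B true

  ~-sym : ∀ {x y} → x ~ y → y ~ x
  ~-sym = sym G _ _

  ~-≢ : ∀ {x y} → x ~ y → x ≢ y
  ~-≢ {x} x~y refl = irrefl G x x~y

  T-sub : ∀ {x y} → T ∋ x ─ y → x ~ y
  T-sub = EdgeSubset.sub T⊆G _ _

  T-sym : ∀ {x y} → T ∋ x ─ y → T ∋ y ─ x
  T-sym = EdgeSubset.sym T⊆G _ _

  cycle-edge : ∀ k → v k ~ v (suc k)
  cycle-edge k = ∖-sub (adj G) T (v-edge k)

  cycle-edge-not-in-T : ∀ k → ¬ (T ∋ v k ─ v (suc k))
  cycle-edge-not-in-T k = ∖-avoids (adj G) T (v-edge k)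

  0<suc : ∀ {j} → 0 < suc j
  0<suc = s≤s z≤n

  1<L : 1 < L
  1<L = s≤s (s≤s z≤n)

  2<L : 2 < L
  2<L = s≤s (s≤s (s≤s z≤n))

  3<L : 3 < L
  3<L = +-monoʳ-< 3 long

  -- t x is a chosen T-neighbour of x; it exists since x has a G-neighbour
  -- a ≠ x and T connects x to a.
  tree-neighbour : ∀ x → Σ (Fin n) λ y → T ∋ x ─ y
  tree-neighbour x with cubic x
  ... | a , _ , _ , _ , _ , _ , x~a , _ = first-edge (T-connected x a) (~-≢ x~a)

  t : Fin n → Fin n
  t x = proj₁ (tree-neighbour x)

  t-edge : ∀ x → T ∋ x ─ t x
  t-edge x = proj₂ (tree-neighbour x)

  -- The neighbourhood of a cycle vertex: its two cycle neighbours and its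
  -- tree neighbour (the cycle edges are not tree edges).
  neighbours : ∀ k {w} → v (suc k) ~ w → OneOf (v k) (v (2 + k)) (t (v (suc k))) w
  neighbours k = three-neighbours (adj G) (cubic (v (suc k)))
    (v-distinct k 2 0<suc 2<L) back≢t forth≢t (~-sym (cycle-edge k)) (cycle-edge (suc k)) (T-sub (t-edge _))
    where
      back≢t : v k ≢ t (v (suc k))
      back≢t e = cycle-edge-not-in-T k (T-sym (subst (T ∋ v (suc k) ─_) (≡-sym e) (t-edge _)))
      forth≢t : v (2 + k) ≢ t (v (suc k))
      forth≢t e = cycle-edge-not-in-T (suc k) (subst (T ∋ v (suc k) ─_) (≡-sym e) (t-edge _))

  leaf : ∀ j {w} → T ∋ v j ─ w → w ≡ t (v j)
  leaf j {w} vj-w rewrite v-as-successor j = at-successor (2 + m C + j) vj-w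
    where
      at-successor : ∀ k → T ∋ v (suc k) ─ w → w ≡ t (v (suc k))
      at-successor k tree-edge with neighbours k (T-sub tree-edge)
      ... | inj₁ refl        = ⊥-elim (cycle-edge-not-in-T k (T-sym tree-edge))
      ... | inj₂ (inj₁ refl) = ⊥-elim (cycle-edge-not-in-T (suc k) tree-edge)
      ... | inj₂ (inj₂ w≡t)  = w≡t

  OffCycle : Fin n → Set
  OffCycle x = ∀ j → x ≢ v j

  -- Tree neighbours lie off the cycle: otherwise {v j, v k} would be a
  -- T-closed set, missing one of three distinct consecutive cycle vertices.
  t-off-cycle : ∀ j → OffCycle (t (v j))
  t-off-cycle j k t≡vk = three-in-two (everything (v k)) (everything (v (1 + k))) (everything (v (2 + k)))
    (v-distinct k 1 0<suc 1<L) (v-distinct k 2 0<suc 2<L) (v-distinct (1 + k) 1 0<suc 1<L)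
    where
      Pair : Fin n → Set
      Pair y = y ≡ v j ⊎ y ≡ v k
      tk≡vj : t (v k) ≡ v j
      tk≡vj = ≡-sym (leaf k (T-sym (subst (T ∋ v j ─_) t≡vk (t-edge (v j)))))
      closed : Closed T Pair
      closed _ y (inj₁ refl) e = inj₂ (trans (leaf j e) t≡vk)
      closed _ y (inj₂ refl) e = inj₁ (trans (leaf k e) tk≡vj)
      everything : ∀ y → Pair y
      everything = closed-total T-connected closed (inj₁ refl)

  off-cycle-neighbour : ∀ j {x} → v j ~ x → OffCycle x → x ≡ t (v j)
  off-cycle-neighbour j {x} vj~x off rewrite v-as-successor j with neighbours (2 + m C + j) vj~x
  ... | inj₁ x≡v         = ⊥-elim (off (2 + m C + j) x≡v)
  ... | inj₂ (inj₁ x≡v)  = ⊥-elim (off (2 + (2 + m C + j)) x≡v)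
  ... | inj₂ (inj₂ x≡t)  = x≡t

  cycle-neighbours : ∀ k j → v (suc k) ~ v j → v j ≡ v k ⊎ v j ≡ v (2 + k)
  cycle-neighbours k j h with neighbours k h
  ... | inj₁ e        = inj₁ e
  ... | inj₂ (inj₁ e) = inj₂ e
  ... | inj₂ (inj₂ e) = ⊥-elim (t-off-cycle (suc k) j (≡-sym e))

  chordless : Chordless G C
  chordless i i′ h = subst (λ c → i′ ≡ next c ⊎ c ≡ next i′) (pos-as-successor i)
    (positions (2 + m C + toℕ i) (subst (_~ vert C i′) (vert-as-successor i) h))
    where
      position : ∀ a → v (toℕ i′) ≡ v a → i′ ≡ pos a
      position a e = trans (≡-sym (pos-toℕ i′)) (inj C e)
      positions : ∀ k → v (suc k) ~ vert C i′ → i′ ≡ next (pos (suc k)) ⊎ pos (suc k) ≡ next i′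
      positions k h′ with cycle-neighbours k (toℕ i′) (subst (v (suc k) ~_) (≡-sym (v-toℕ i′)) h′)
      ... | inj₁ e = inj₂ (trans (pos-suc k) (cong next (≡-sym (position k e))))
      ... | inj₂ e = inj₁ (trans (position (2 + k) e) (pos-suc (suc k)))

  -- In particular v k and v (2 + k) are not adjacent (this uses L ≥ 4).
  no-skip : ∀ k → ¬ (v k ~ v (2 + k))
  no-skip k h with cycle-neighbours (suc k) k (~-sym h)
  ... | inj₁ e = v-distinct k 1 0<suc 1<L e
  ... | inj₂ e = v-distinct k 3 0<suc 3<L e

  SameTreeNeighbour : ℕ → Set
  SameTreeNeighbour k = t (v k) ≡ t (v (suc k))

  tree-neighbour-adjacent : ∀ j → t (v j) ~ v j
  tree-neighbour-adjacent j = ~-sym (T-sub (t-edge (v j)))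

  -- No three consecutive cycle vertices share their tree neighbour c: else
  -- c (of degree 3) with these three T-leaves would be a T-closed set
  -- missing v (3 + k).
  no-three-share : ∀ k → ¬ (SameTreeNeighbour k × SameTreeNeighbour (suc k))
  no-three-share k (same₀ , same₁) = outside (closed-total T-connected closed (inj₁ refl) (v (3 + k)))
    where
      c : Fin n
      c = t (v k)
      Star : Fin n → Set
      Star y = y ≡ c ⊎ OneOf (v k) (v (1 + k)) (v (2 + k)) y
      closed : Closed T Star
      closed _ y (inj₁ refl) e = inj₂ (three-neighbours (adj G) (cubic c)
        (v-distinct k 1 0<suc 1<L) (v-distinct k 2 0<suc 2<L) (v-distinct (1 + k) 1 0<suc 1<L)
        (tree-neighbour-adjacent k)
        (subst (_~ v (1 + k)) (≡-sym same₀) (tree-neighbour-adjacent (1 + k)))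
        (subst (_~ v (2 + k)) (≡-sym (trans same₀ same₁)) (tree-neighbour-adjacent (2 + k)))
        (T-sub e))
      closed _ y (inj₂ (inj₁ refl))        e = inj₁ (leaf k e)
      closed _ y (inj₂ (inj₂ (inj₁ refl))) e = inj₁ (trans (leaf (1 + k) e) (≡-sym same₀))
      closed _ y (inj₂ (inj₂ (inj₂ refl))) e = inj₁ (trans (leaf (2 + k) e) (≡-sym (trans same₀ same₁)))
      outside : ¬ Star (v (3 + k))
      outside (inj₁ e)                 = t-off-cycle k (3 + k) (≡-sym e)
      outside (inj₂ (inj₁ e))          = v-distinct k 3 0<suc 3<L (≡-sym e)
      outside (inj₂ (inj₂ (inj₁ e)))   = v-distinct (1 + k) 2 0<suc 2<L (≡-sym e)
      outside (inj₂ (inj₂ (inj₂ e)))   = v-distinct (2 + k) 1 0<suc 1<L (≡-sym e)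

  -- Claw-freeness at v (1 + k): its tree neighbour must be adjacent to
  -- v k or v (2 + k), hence equal to that vertex's tree neighbour.
  one-shares : ∀ k → SameTreeNeighbour k ⊎ SameTreeNeighbour (suc k)
  one-shares k with adjacent? (v k) (t (v (suc k))) | adjacent? (v (2 + k)) (t (v (suc k)))
  ... | yes h | _     = inj₁ (≡-sym (off-cycle-neighbour k h (t-off-cycle (suc k))))
  ... | no _  | yes h = inj₂ (off-cycle-neighbour (2 + k) h (t-off-cycle (suc k)))
  ... | no h₀ | no h₂ = ⊥-elim (claw-free (v (suc k) , v k , v (2 + k) , t (v (suc k)) ,
    v-distinct k 2 0<suc 2<L , (λ e → t-off-cycle (suc k) k (≡-sym e)) , (λ e → t-off-cycle (suc k) (2 + k) (≡-sym e)) ,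
    ~-sym (cycle-edge k) , cycle-edge (suc k) , T-sub (t-edge _) ,
    no-skip k , h₀ , h₂))

  even-length : EvenLength C
  even-length = alternating-period-even SameTreeNeighbour one-shares no-three-share L periodic
    where
      open ≡-Reasoning
      periodic : ∀ k → SameTreeNeighbour k → SameTreeNeighbour (L + k)
      periodic k same = begin
        t (v (L + k))        ≡⟨ cong t (v-periodic k) ⟩
        t (v k)              ≡⟨ same ⟩
        t (v (suc k))        ≡⟨ cong t (≡-sym (v-periodic (suc k))) ⟩
        t (v (L + suc k))    ≡⟨ cong (t ∘ v) (+-suc L k) ⟩
        t (v (suc (L + k)))  ∎

  tree-neighbour-not-both : ∀ k → t (v (suc k)) ~ v k → t (v (suc k)) ~ v (2 + k) → ⊥
  tree-neighbour-not-both k h₀ h₂ = no-three-share k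
    (≡-sym (off-cycle-neighbour k (~-sym h₀) (t-off-cycle (suc k))) ,
     off-cycle-neighbour (2 + k) (~-sym h₂) (t-off-cycle (suc k)))

  -- An edge at a cycle vertex lies in at most one triangle.
  one-triangle : ∀ j {a b c d} → a ≡ v j → a ~ b → a ~ c → a ~ d → c ≢ d → b ~ c → b ~ d → ⊥
  one-triangle j a≡vj = at-successor (2 + m C + j) (trans a≡vj (v-as-successor j))
    where
      at-successor : ∀ k {a b c d} → a ≡ v (suc k) → a ~ b → a ~ c → a ~ d → c ≢ d → b ~ c → b ~ d → ⊥
      at-successor k refl a~b a~c a~d c≢d b~c b~d with neighbours k a~b
      ... | inj₁ refl with distinct-in-pair (drop₁ (neighbours k a~c) (~-≢ b~c ∘ ≡-sym))
                                            (drop₁ (neighbours k a~d) (~-≢ b~d ∘ ≡-sym)) c≢d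
      ...   | inj₁ (refl , _) = no-skip k b~c
      ...   | inj₂ (_ , refl) = no-skip k b~d
      at-successor k refl a~b a~c a~d c≢d b~c b~d | inj₂ (inj₁ refl)
        with distinct-in-pair (drop₂ (neighbours k a~c) (~-≢ b~c ∘ ≡-sym))
                              (drop₂ (neighbours k a~d) (~-≢ b~d ∘ ≡-sym)) c≢d
      ...   | inj₁ (refl , _) = no-skip k (~-sym b~c)
      ...   | inj₂ (_ , refl) = no-skip k (~-sym b~d)
      at-successor k refl a~b a~c a~d c≢d b~c b~d | inj₂ (inj₂ refl)
        with distinct-in-pair (drop₃ (neighbours k a~c) (~-≢ b~c ∘ ≡-sym))
                              (drop₃ (neighbours k a~d) (~-≢ b~d ∘ ≡-sym)) c≢d
      ...   | inj₁ (refl , refl) = tree-neighbour-not-both k b~c b~d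
      ...   | inj₂ (refl , refl) = tree-neighbour-not-both k b~d b~c

  -- Hence no cycle vertex lies in a diamond abcd (edges ab, ac, ad, bc, bd):
  -- a and b each see an edge in two triangles, so neither is on C; and if
  -- c or d is on C, one of its two neighbours a, b is on C as well.
  not-in-diamond : ∀ i → ¬ InDiamond G (vert C i)
  not-in-diamond i (a , b , c , d , a≢b , _ , _ , _ , _ , c≢d , a~b , a~c , a~d , b~c , b~d , position) =
    by-position position
    where
      k : ℕ
      k = 2 + m C + toℕ i
      a-off : OffCycle a
      a-off j a≡vj = one-triangle j a≡vj a~b a~c a~d c≢d b~c b~d
      b-off : OffCycle b
      b-off j b≡vj = one-triangle j b≡vj (~-sym a~b) b~c b~d c≢d a~c a~d
      common-neighbour : ∀ {x} → vert C i ≡ x → x ~ a → x ~ b → ⊥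
      common-neighbour refl x~a x~b
        with one-in-first-two (neighbours k (subst (_~ a) (vert-as-successor i) x~a))
                              (neighbours k (subst (_~ b) (vert-as-successor i) x~b)) a≢b
      ... | inj₁ (inj₁ a≡v) = a-off k a≡v
      ... | inj₁ (inj₂ a≡v) = a-off (2 + k) a≡v
      ... | inj₂ (inj₁ b≡v) = b-off k b≡v
      ... | inj₂ (inj₂ b≡v) = b-off (2 + k) b≡v
      on-cycle : vert C i ≡ v (toℕ i)
      on-cycle = ≡-sym (v-toℕ i)
      by-position : ¬ (vert C i ≡ a ⊎ vert C i ≡ b ⊎ vert C i ≡ c ⊎ vert C i ≡ d)
      by-position (inj₁ x≡a)               = a-off (toℕ i) (trans (≡-sym x≡a) on-cycle)
      by-position (inj₂ (inj₁ x≡b))        = b-off (toℕ i) (trans (≡-sym x≡b) on-cycle)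
      by-position (inj₂ (inj₂ (inj₁ x≡c))) = common-neighbour x≡c (~-sym a~c) (~-sym b~c)
      by-position (inj₂ (inj₂ (inj₂ x≡d))) = common-neighbour x≡d (~-sym a~d) (~-sym b~d)

lemma2p2 : ∀ {n : ℕ} (G : Graph n) → Connected G → ClawFree G → Cubic G →
    ∀ (T M O : EdgeRel n) → GoodDecomposition G T M O →
    (C : Cycle (adj G ∖ T)) →
      IsTriangle C ⊎
      (Chordless G C × (∀ i → ¬ InDiamond G (vert C i)) × EvenLength C)
lemma2p2 G _ claw-free cubic T _ _ decomposition C with m C ≟ℕ 0
... | yes triangle = inj₁ triangle
... | no  longer   = inj₂ (chordless , not-in-diamond , even-length)
  where
    open GoodDecomposition decomposition using (tree)
    open CycleOffTree G claw-free cubic T (proj₁ tree) (proj₁ (proj₂ tree)) C (n≢0⇒n>0 longer)
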